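{- Let $G$ be a finite group and let $\mathrm{Endo}(G^*)$ be the subgraph of $\mathrm{Endo}(G)$ induced by $G \setminus \{e\}$. Then $\mathrm{Endo}(G^*)$ is a tree if and only if $G \cong \mathbb{Z}_2$ or $G \cong \mathbb{Z}_3$.
   Context: For a finite group $G$ with identity $e$, $\mathrm{Endo}(G)$ is the simple undirected graph with vertex set $G$ in which distinct $a,b$ are adjacent iff there is a group endomorphism of $G$ mapping $a$ to $b$ or mapping $b$ to $a$. -}

module Defs where

open import Level using (Level; _⊔_; 0ℓ)
open import Data.Nat using (ℕ; suc; _+_; _∸_; NonZero)
open import Data.Nat.DivMod using (_mod_)
open import Data.Fin using (Fin; zero; suc; toℕ; fromℕ)
open import Data.Product using (Σ; ∃; _×_; _,_; proj₁)
open import Data.Sum using (_⊎_)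
open import Data.Empty using (⊥)
open import Relation.Nullary using (¬_)
open import Relation.Binary.PropositionalEquality as ≡ using (_≡_; _≢_)
open import Relation.Binary.Construct.Closure.ReflexiveTransitive using (Star)
open import Algebra.Bundles using (Group)
open import Algebra.Bundles.Raw using (RawGroup)
open import Algebra.Morphism.Structures using (module GroupMorphisms)
open import Function.Bundles using (Inverse)

IsFinite : ∀ {c ℓ} → Group c ℓ → Set (c ⊔ ℓ)
IsFinite G = ∃ λ n → Inverse (≡.setoid (Fin n)) (Group.setoid G)

IsEndomorphism : ∀ {c ℓ} (G : Group c ℓ) → (Group.Carrier G → Group.Carrier G) → Set (c ⊔ ℓ)
IsEndomorphism G f = GroupMorphisms.IsGroupHomomorphism (Group.rawGroup G) (Group.rawGroup G) f

module _ (n : ℕ) .{{_ : NonZero n}} where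
  _+ₙ_ : Fin n → Fin n → Fin n
  a +ₙ b = (toℕ a + toℕ b) mod n

  -ₙ_ : Fin n → Fin n
  -ₙ a = (n ∸ toℕ a) mod n

  ℤ-raw : RawGroup 0ℓ 0ℓ
  ℤ-raw = record
    { Carrier = Fin n
    ; _≈_ = _≡_
    ; _∙_ = _+ₙ_
    ; ε = 0 mod n
    ; _⁻¹ = -ₙ_
    }

_≅ℤ_ : ∀ {c ℓ} → Group c ℓ → (n : ℕ) → .{{NonZero n}} → Set (c ⊔ ℓ)
G ≅ℤ n = ∃ λ (φ : Group.Carrier G → Fin n) →
  GroupMorphisms.IsGroupIsomorphism (Group.rawGroup G) (ℤ-raw n) φ

record Graph (v ℓ e : Level) : Set (Level.suc (v ⊔ ℓ ⊔ e)) where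
  field
    V   : Set v
    _≃_ : V → V → Set ℓ   -- equality of vertices (an equivalence)
    Adj : V → V → Set e

module _ {v ℓ e} (Γ : Graph v ℓ e) where
  open Graph Γ

  Connected : Set (v ⊔ ℓ ⊔ e)
  Connected = ∀ x y → x ≃ y ⊎ Star Adj x y

  -- a cycle: k ≥ 3 pairwise distinct vertices w₀,…,w_{k-1} with
  -- w_i adjacent to w_{i+1} and w_{k-1} adjacent to w₀
  Cycle : Set (v ⊔ ℓ ⊔ e)
  Cycle = ∃ λ m → Σ (Fin (suc (suc (suc m))) → V) λ w →
      (∀ i j → i ≢ j → ¬ (w i ≃ w j))
    × (∀ i j → suc (toℕ i) ≡ toℕ j → Adj (w i) (w j))
    × Adj (w (fromℕ (suc (suc m)))) (w zero)

  Acyclic : Set (v ⊔ ℓ ⊔ e)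
  Acyclic = ¬ Cycle

  IsTree : Set (v ⊔ ℓ ⊔ e)
  IsTree = V × Connected × Acyclic

EndoStar : ∀ {c ℓ} → Group c ℓ → Graph (c ⊔ ℓ) ℓ (c ⊔ ℓ)
EndoStar G = record
  { V = Σ Carrier (λ x → ¬ (x ≈ ε))
  ; _≃_ = λ a b → proj₁ a ≈ proj₁ b
  ; Adj = λ a b → ¬ (proj₁ a ≈ proj₁ b)
      × ((∃ λ f → IsEndomorphism G f × f (proj₁ a) ≈ proj₁ b)
        ⊎ (∃ λ f → IsEndomorphism G f × f (proj₁ b) ≈ proj₁ a))
  }
  where open Group G

-- If u ≠ v are non-identity elements with endomorphisms u ↦ v and v ↦ u, then any vertex
-- adjacent to u or v is comparable with both, so in a tree it must be u or v, and by
-- connectedness G* = {u, v}. Since a and g a g⁻¹ are mutually reachable by conjugations,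
-- this forces G to be abelian, so inversion is an endomorphism: if a⁻¹ ≠ a then
-- G = {ε, a, a⁻¹} ≅ ℤ₃. If a⁻¹ = a, the same argument applied to z, z⁻¹ shows that G has
-- exponent two; then every non-identity x can be sent to any t (map an index-two subgroup
-- avoiding x to ε and its other coset to t), so for z ∉ {ε, a} the pair a, z would
-- exhaust G* although a z is a third vertex; hence G ≅ ℤ₂. Conversely Endo(ℤ₂*) is a
-- single vertex and Endo(ℤ₃*) a single edge.

module Submission where

open import Defs
open import Level using (_⊔_)
open import Data.Nat as ℕ using (NonZero)
open import Data.Nat.DivMod using (_mod_)
import Data.Nat.Properties as ℕₚ
open import Data.Bool using (Bool; true; false; T; _∨_; if_then_else_)
open import Data.Bool.Properties using (T-∨; T?)
open import Data.Unit using (tt)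
open import Data.Fin using (Fin; zero; suc; toℕ)
import Data.Fin.Properties as Fin
open import Data.List using (List; []; _∷_; tabulate)
import Data.List.Relation.Unary.Any.Properties as Any
open import Data.List.Relation.Unary.Any using (here; there)
open import Data.Product using (∃; _×_; _,_; proj₁; proj₂)
open import Data.Sum using (_⊎_; inj₁; inj₂; [_,_]′)
import Data.Sum as Sum
open import Data.Empty using (⊥-elim)
open import Function.Base using (_∘_; id; flip)
open import Function.Bundles using (_⇔_; mk⇔; Inverse; Equivalence)
open import Function.Properties.Inverse using (Inverse⇒Injection)
import Function.Construct.Symmetry as Symmetry
open import Relation.Nullary using (¬_; yes; no; contradiction)
open import Relation.Nullary.Decidable using (via-injection; decidable-stable; ⌊_⌋; fromWitness; toWitness)
open import Relation.Binary.Definitions using (Decidable)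
open import Relation.Binary.PropositionalEquality as ≡ using (_≡_; _≢_)
open import Relation.Binary.Construct.Closure.ReflexiveTransitive using (Star; _◅_) renaming (ε to ε★)
open import Algebra.Bundles using (Group; CommutativeSemigroup)
open import Algebra.Definitions using (Commutative)
open import Algebra.Morphism.Structures using (module GroupMorphisms)
import Algebra.Morphism.Construct.Identity as Identity
import Algebra.Morphism.Construct.Composition as Composition

module _ {v ℓ e} (Γ : Graph v ℓ e) where
  open Graph Γ

  triangle⇒cycle : (∀ {x y} → x ≃ y → y ≃ x) →
                   ∀ {x y z} → ¬ x ≃ y → ¬ y ≃ z → ¬ x ≃ z →
                   Adj x y → Adj y z → Adj z x → Cycle Γ
  triangle⇒cycle sym {x} {y} {z} x≄y y≄z x≄z xy yz zx = 0 , w , distinct , path , zx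
    where
    w : Fin 3 → V
    w zero             = x
    w (suc zero)       = y
    w (suc (suc zero)) = z

    distinct : ∀ i j → i ≢ j → ¬ w i ≃ w j
    distinct zero             zero             i≢j = contradiction ≡.refl i≢j
    distinct zero             (suc zero)       _   = x≄y
    distinct zero             (suc (suc zero)) _   = x≄z
    distinct (suc zero)       zero             _   = x≄y ∘ sym
    distinct (suc zero)       (suc zero)       i≢j = contradiction ≡.refl i≢j
    distinct (suc zero)       (suc (suc zero)) _   = y≄z
    distinct (suc (suc zero)) zero             _   = x≄z ∘ sym
    distinct (suc (suc zero)) (suc zero)       _   = y≄z ∘ sym
    distinct (suc (suc zero)) (suc (suc zero)) i≢j = contradiction ≡.refl i≢j

    path : ∀ i j → ℕ.suc (toℕ i) ≡ toℕ j → Adj (w i) (w j)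
    path zero             (suc zero)       _ = xy
    path (suc zero)       (suc (suc zero)) _ = yz
    path zero             zero             ()
    path zero             (suc (suc zero)) ()
    path (suc zero)       zero             ()
    path (suc zero)       (suc zero)       ()
    path (suc (suc zero)) zero             ()
    path (suc (suc zero)) (suc zero)       ()
    path (suc (suc zero)) (suc (suc zero)) ()

  at-most-two-vertices⇒acyclic : (∀ x y z → x ≃ y ⊎ y ≃ z ⊎ x ≃ z) → Acyclic Γ
  at-most-two-vertices⇒acyclic two (_ , w , distinct , _)
    with two (w zero) (w (suc zero)) (w (suc (suc zero)))
  ... | inj₁ w₀≃w₁        = distinct zero (suc zero) (λ ()) w₀≃w₁
  ... | inj₂ (inj₁ w₁≃w₂) = distinct (suc zero) (suc (suc zero)) (λ ()) w₁≃w₂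
  ... | inj₂ (inj₂ w₀≃w₂) = distinct zero (suc (suc zero)) (λ ()) w₀≃w₂

  adjacency-closed⇒universal : Connected Γ → ∀ {p} (P : V → Set p) →
                               (∀ {x y} → x ≃ y → P x → P y) →
                               (∀ x y → Adj x y → P x → P y) →
                               ∀ {x} → P x → ∀ y → P y
  adjacency-closed⇒universal connected P resp step {x} Px y with connected x y
  ... | inj₁ x≃y  = resp x≃y Px
  ... | inj₂ walk = along walk Px
    where
    along : ∀ {x y} → Star Adj x y → P x → P y
    along ε★          Px = Px
    along (xy ◅ walk) Px = along walk (step _ _ xy Px)

module Endomorphisms {c ℓ} (G : Group c ℓ) where
  open Group G
  open import Algebra.Properties.Group G
  open import Relation.Binary.Reasoning.Setoid setoid

  isEndomorphism : ∀ {f} → (∀ {x y} → x ≈ y → f x ≈ f y) →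
                   (∀ x y → f (x ∙ y) ≈ f x ∙ f y) → IsEndomorphism G f
  isEndomorphism {f} f-cong f-homo = record
    { isMonoidHomomorphism = record
      { isMagmaHomomorphism = record
        { isRelHomomorphism = record { cong = f-cong }
        ; homo = f-homo
        }
      ; ε-homo = f-ε
      }
    ; ⁻¹-homo = λ x → inverseˡ-unique (f (x ⁻¹)) (f x)
                        (trans (sym (f-homo (x ⁻¹) x)) (trans (f-cong (inverseˡ x)) f-ε))
    }
    where
    f-ε : f ε ≈ ε
    f-ε = identityʳ-unique (f ε) (f ε) (trans (sym (f-homo ε ε)) (f-cong (identityˡ ε)))

  infix 4 _↝_
  _↝_ : Carrier → Carrier → Set (c ⊔ ℓ)
  a ↝ b = ∃ λ f → IsEndomorphism G f × f a ≈ b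

  ≈⇒↝ : ∀ {a b} → a ≈ b → a ↝ b
  ≈⇒↝ a≈b = id , Identity.isGroupHomomorphism rawGroup refl , a≈b

  ↝-trans : ∀ {a b c} → a ↝ b → b ↝ c → a ↝ c
  ↝-trans (f , f-endo , fa≈b) (g , g-endo , gb≈c) =
    g ∘ f , Composition.isGroupHomomorphism trans f-endo g-endo ,
    trans (GroupMorphisms.IsGroupHomomorphism.⟦⟧-cong g-endo fa≈b) gb≈c

  Comparable : Carrier → Carrier → Set (c ⊔ ℓ)
  Comparable a b = a ↝ b ⊎ b ↝ a

  comparable-transfer : ∀ {u v x} → u ↝ v → v ↝ u → Comparable u x → Comparable v x
  comparable-transfer u↝v v↝u = Sum.map (↝-trans v↝u) (λ x↝u → ↝-trans x↝u u↝v)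

  comparable-resp : ∀ {u v x} → u ≈ v → Comparable u x → Comparable v x
  comparable-resp u≈v = comparable-transfer (≈⇒↝ u≈v) (≈⇒↝ (sym u≈v))

  conjugate : Carrier → Carrier → Carrier
  conjugate g z = g ∙ z ∙ g ⁻¹

  conjugate-isEndomorphism : ∀ g → IsEndomorphism G (conjugate g)
  conjugate-isEndomorphism g = isEndomorphism (λ z≈w → ∙-congʳ (∙-congˡ z≈w)) λ z w → begin
    g ∙ (z ∙ w) ∙ g ⁻¹              ≈⟨ ∙-congʳ (assoc g z w) ⟨
    g ∙ z ∙ w ∙ g ⁻¹                ≈⟨ ∙-congʳ (∙-congʳ (//-rightDividesˡ g (g ∙ z))) ⟨
    g ∙ z ∙ g ⁻¹ ∙ g ∙ w ∙ g ⁻¹      ≈⟨ ∙-congʳ (assoc (g ∙ z ∙ g ⁻¹) g w) ⟩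
    g ∙ z ∙ g ⁻¹ ∙ (g ∙ w) ∙ g ⁻¹    ≈⟨ assoc (g ∙ z ∙ g ⁻¹) (g ∙ w) (g ⁻¹) ⟩
    g ∙ z ∙ g ⁻¹ ∙ (g ∙ w ∙ g ⁻¹)    ∎

  ↝-conjugate : ∀ g a → a ↝ conjugate g a
  ↝-conjugate g a = conjugate g , conjugate-isEndomorphism g , refl

  conjugate-↝ : ∀ g a → conjugate g a ↝ a
  conjugate-↝ g a = conjugate (g ⁻¹) , conjugate-isEndomorphism (g ⁻¹) , (begin
    g ⁻¹ ∙ (g ∙ a ∙ g ⁻¹) ∙ g ⁻¹ ⁻¹  ≈⟨ ∙-congˡ (⁻¹-involutive g) ⟩
    g ⁻¹ ∙ (g ∙ a ∙ g ⁻¹) ∙ g        ≈⟨ ∙-congʳ (assoc (g ⁻¹) (g ∙ a) (g ⁻¹)) ⟨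
    g ⁻¹ ∙ (g ∙ a) ∙ g ⁻¹ ∙ g        ≈⟨ //-rightDividesˡ g (g ⁻¹ ∙ (g ∙ a)) ⟩
    g ⁻¹ ∙ (g ∙ a)                  ≈⟨ \\-leftDividesʳ g a ⟩
    a                               ∎)

  ⁻¹-isEndomorphism : Commutative _≈_ _∙_ → IsEndomorphism G _⁻¹
  ⁻¹-isEndomorphism comm =
    isEndomorphism ⁻¹-cong (λ x y → trans (⁻¹-anti-homo-∙ x y) (comm (y ⁻¹) (x ⁻¹)))

module EndoStarTree {c ℓ} (G : Group c ℓ) (_≟_ : Decidable (Group._≈_ G))
                   (connected : Connected (EndoStar G)) (acyclic : Acyclic (EndoStar G)) where
  open Group G
  open Endomorphisms G
  open Graph (EndoStar G) using (V; Adj)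

  mutually-reachable⇒exhaustive : ∀ {u v} → u ≉ ε → v ≉ ε → u ≉ v → u ↝ v → v ↝ u →
                                  ∀ {y} → y ≉ ε → y ≈ u ⊎ y ≈ v
  mutually-reachable⇒exhaustive {u} {v} u≉ε v≉ε u≉v u↝v v↝u {y} y≉ε =
    Sum.map sym sym (adjacency-closed⇒universal (EndoStar G) connected Near
                       (λ x≈y → Sum.map (λ u≈x → trans u≈x x≈y) (λ v≈x → trans v≈x x≈y))
                       step {u , u≉ε} (inj₁ refl) (y , y≉ε))
    where
    Near : V → Set ℓ
    Near x = u ≈ proj₁ x ⊎ v ≈ proj₁ x

    step : ∀ w x → Adj w x → Near w → Near x
    step w x (_ , w~x) w-near with u ≟ proj₁ x | v ≟ proj₁ x
    ... | yes u≈x | _       = inj₁ u≈x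
    ... | no _    | yes v≈x = inj₂ v≈x
    ... | no u≉x  | no v≉x  = contradiction triangle acyclic
      where
      u~x : Comparable u (proj₁ x)
      u~x = [ (λ u≈w → comparable-resp (sym u≈w) w~x)
            , (λ v≈w → comparable-transfer v↝u u↝v (comparable-resp (sym v≈w) w~x)) ]′ w-near

      triangle : Cycle (EndoStar G)
      triangle = triangle⇒cycle (EndoStar G) sym {u , u≉ε} {v , v≉ε} {x}
                   u≉v v≉x u≉x (u≉v , inj₁ u↝v)
                   (v≉x , comparable-transfer u↝v v↝u u~x) (u≉x ∘ sym , Sum.swap u~x)

module Finite {c ℓ} (G : Group c ℓ) (finite : IsFinite G) where
  open Group G
  open import Data.List.Membership.Setoid setoid using (_∈_)
  open Inverse (proj₂ finite) using (to; from; strictlyInverseˡ)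

  infix 4 _≟_
  _≟_ : Decidable _≈_
  _≟_ = via-injection (Inverse⇒Injection (Symmetry.inverse (proj₂ finite))) Fin._≟_

  elements : List Carrier
  elements = tabulate to

  ∈-elements : ∀ z → z ∈ elements
  ∈-elements z = Any.tabulate⁺ (from z) (sym (strictlyInverseˡ z))

HasExponentTwo : ∀ {c ℓ} → Group c ℓ → Set (c ⊔ ℓ)
HasExponentTwo G = ∀ z → z ∙ z ≈ ε
  where open Group G

module ExponentTwo {c ℓ} (G : Group c ℓ) (finite : IsFinite G) (square≈ε : HasExponentTwo G) where
  open Group G
  open import Algebra.Properties.Group G
  open import Data.List.Membership.Setoid setoid using (_∈_)
  open Endomorphisms G
  open Finite G finite
  open Equivalence using (to; from)

  z∙zw≈w : ∀ z w → z ∙ (z ∙ w) ≈ w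
  z∙zw≈w z w = trans (sym (assoc z z w)) (trans (∙-congʳ (square≈ε z)) (identityˡ w))

  self-inverse : ∀ z → z ≈ z ⁻¹
  self-inverse z = inverseˡ-unique z z (square≈ε z)

  comm : Commutative _≈_ _∙_
  comm z w = trans (self-inverse (z ∙ w))
                   (trans (⁻¹-anti-homo-∙ z w) (sym (∙-cong (self-inverse w) (self-inverse z))))

  commutativeSemigroup : CommutativeSemigroup c ℓ
  commutativeSemigroup = record
    { isCommutativeSemigroup = record { isSemigroup = isSemigroup ; comm = comm } }

  open import Algebra.Properties.CommutativeSemigroup commutativeSemigroup
    using (interchange; x∙yz≈y∙xz)

  yz∙yw≈z∙w : ∀ y z w → y ∙ z ∙ (y ∙ w) ≈ z ∙ w
  yz∙yw≈z∙w y z w = trans (interchange y z y w) (trans (∙-congʳ (square≈ε y)) (identityˡ (z ∙ w)))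

  -- Subsets are Bool-valued predicates; in exponent two, a subset containing ε and closed
  -- under ∙ is a subgroup.
  record AvoidingSubgroup (x : Carrier) (h : Carrier → Bool) : Set (c ⊔ ℓ) where
    field
      ∈-resp   : ∀ {z w} → z ≈ w → T (h z) → T (h w)
      ε∈       : T (h ε)
      ∙-closed : ∀ {z w} → T (h z) → T (h w) → T (h (z ∙ w))
      x∉       : ¬ T (h x)

  module _ {x : Carrier} where

    trivial-avoiding : x ≉ ε → AvoidingSubgroup x (λ z → ⌊ z ≟ ε ⌋)
    trivial-avoiding x≉ε = record
      { ∈-resp   = λ {z} {w} z≈w z∈ → fromWitness {a? = w ≟ ε} (trans (sym z≈w) (toWitness z∈))
      ; ε∈       = fromWitness {a? = ε ≟ ε} refl
      ; ∙-closed = λ {z} {w} z∈ w∈ → fromWitness {a? = z ∙ w ≟ ε}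
                     (trans (∙-cong (toWitness z∈) (toWitness w∈)) (identityˡ ε))
      ; x∉       = x≉ε ∘ toWitness
      }

    adjoin : (Carrier → Bool) → Carrier → Carrier → Bool
    adjoin h y z = h z ∨ h (y ∙ z)

    adjoin-avoiding : ∀ {h y} → AvoidingSubgroup x h → ¬ T (h (x ∙ y)) →
                      AvoidingSubgroup x (adjoin h y)
    adjoin-avoiding {h} {y} H xy∉ = record
      { ∈-resp   = λ z≈w → from T-∨ ∘ Sum.map (∈-resp z≈w) (∈-resp (∙-congˡ z≈w)) ∘ to T-∨
      ; ε∈       = from T-∨ (inj₁ ε∈)
      ; ∙-closed = λ z∈ w∈ → from T-∨ (closed (to T-∨ z∈) (to T-∨ w∈))
      ; x∉       = [ x∉ , xy∉ ∘ ∈-resp (comm y x) ]′ ∘ to T-∨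
      }
      where
      open AvoidingSubgroup H
      closed : ∀ {z w} → T (h z) ⊎ T (h (y ∙ z)) → T (h w) ⊎ T (h (y ∙ w)) →
               T (h (z ∙ w)) ⊎ T (h (y ∙ (z ∙ w)))
      closed {z} {w} (inj₁ z∈)  (inj₁ w∈)  = inj₁ (∙-closed z∈ w∈)
      closed {z} {w} (inj₁ z∈)  (inj₂ yw∈) = inj₂ (∈-resp (x∙yz≈y∙xz z y w) (∙-closed z∈ yw∈))
      closed {z} {w} (inj₂ yz∈) (inj₁ w∈)  = inj₂ (∈-resp (assoc y z w) (∙-closed yz∈ w∈))
      closed {z} {w} (inj₂ yz∈) (inj₂ yw∈) = inj₁ (∈-resp (yz∙yw≈z∙w y z w) (∙-closed yz∈ yw∈))

    extend : (Carrier → Bool) → Carrier → Carrier → Bool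
    extend h y = if h (x ∙ y) then h else adjoin h y

    extend-avoiding : ∀ {h y} → AvoidingSubgroup x h → AvoidingSubgroup x (extend h y)
    extend-avoiding {h} {y} H with h (x ∙ y) in xy∈
    ... | true  = H
    ... | false = adjoin-avoiding H (≡.subst T xy∈)

    extend-⊇ : ∀ h y {z} → T (h z) → T (extend h y z)
    extend-⊇ h y z∈ with h (x ∙ y)
    ... | true  = z∈
    ... | false = from T-∨ (inj₁ z∈)

    extend-covers : ∀ {h y} → AvoidingSubgroup x h → T (extend h y y) ⊎ T (extend h y (x ∙ y))
    extend-covers {h} {y} H with h (x ∙ y) in xy∈
    ... | true  = inj₂ (≡.subst T (≡.sym xy∈) tt)
    ... | false = inj₁ (from T-∨ (inj₂ (∈-resp (sym (square≈ε y)) ε∈)))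
      where open AvoidingSubgroup H

    maximal : List Carrier → Carrier → Bool
    maximal []       z = ⌊ z ≟ ε ⌋
    maximal (y ∷ ys)   = extend (maximal ys) y

    maximal-avoiding : x ≉ ε → ∀ ys → AvoidingSubgroup x (maximal ys)
    maximal-avoiding x≉ε []       = trivial-avoiding x≉ε
    maximal-avoiding x≉ε (y ∷ ys) = extend-avoiding (maximal-avoiding x≉ε ys)

    maximal-covers : x ≉ ε → ∀ {ys z} → z ∈ ys → T (maximal ys z) ⊎ T (maximal ys (x ∙ z))
    maximal-covers x≉ε {y ∷ ys} (here z≈y) =
      Sum.map (∈-resp (sym z≈y)) (∈-resp (∙-congˡ (sym z≈y))) (extend-covers (maximal-avoiding x≉ε ys))
      where open AvoidingSubgroup (maximal-avoiding x≉ε (y ∷ ys))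
    maximal-covers x≉ε {y ∷ ys} (there z∈ys) =
      Sum.map (extend-⊇ (maximal ys) y) (extend-⊇ (maximal ys) y) (maximal-covers x≉ε z∈ys)

    index-two⇒↝ : ∀ {h} → AvoidingSubgroup x h → (∀ z → T (h z) ⊎ T (h (x ∙ z))) → ∀ t → x ↝ t
    index-two⇒↝ {h} H covers t = k , isEndomorphism k-cong k-homo , k-∉ x∉
      where
      open AvoidingSubgroup H

      k : Carrier → Carrier
      k z = if h z then ε else t

      k-∈ : ∀ {z} → T (h z) → k z ≈ ε
      k-∈ {z} z∈ with h z
      ... | true  = refl
      ... | false = ⊥-elim z∈

      k-∉ : ∀ {z} → ¬ T (h z) → k z ≈ t
      k-∉ {z} z∉ with h z
      ... | true  = contradiction tt z∉
      ... | false = refl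

      coset : ∀ {z} → ¬ T (h z) → T (h (x ∙ z))
      coset {z} z∉ = [ flip contradiction z∉ , id ]′ (covers z)

      k-cong : ∀ {z w} → z ≈ w → k z ≈ k w
      k-cong {z} z≈w with T? (h z)
      ... | yes z∈ = trans (k-∈ z∈) (sym (k-∈ (∈-resp z≈w z∈)))
      ... | no z∉  = trans (k-∉ z∉) (sym (k-∉ (z∉ ∘ ∈-resp (sym z≈w))))

      k-homo : ∀ z w → k (z ∙ w) ≈ k z ∙ k w
      k-homo z w with T? (h z) | T? (h w)
      ... | yes z∈ | yes w∈ = trans (k-∈ (∙-closed z∈ w∈))
                                    (sym (trans (∙-cong (k-∈ z∈) (k-∈ w∈)) (identityˡ ε)))
      ... | yes z∈ | no w∉  = trans (k-∉ (w∉ ∘ ∈-resp (z∙zw≈w z w) ∘ ∙-closed z∈))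
                                    (sym (trans (∙-cong (k-∈ z∈) (k-∉ w∉)) (identityˡ t)))
      ... | no z∉  | yes w∈ = trans (k-∉ (z∉ ∘ ∈-resp (trans (∙-congˡ (comm z w)) (z∙zw≈w w z))
                                                  ∘ ∙-closed w∈))
                                    (sym (trans (∙-cong (k-∉ z∉) (k-∈ w∈)) (identityʳ t)))
      ... | no z∉  | no w∉  = trans (k-∈ (∈-resp (yz∙yw≈z∙w x z w) (∙-closed (coset z∉) (coset w∉))))
                                    (sym (trans (∙-cong (k-∉ z∉) (k-∉ w∉)) (square≈ε t)))

  nonidentity-↝ : ∀ {x} → x ≉ ε → ∀ t → x ↝ t
  nonidentity-↝ x≉ε =
    index-two⇒↝ (maximal-avoiding x≉ε elements) (λ z → maximal-covers x≉ε (∈-elements z))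

module Recognition {c ℓ} (G : Group c ℓ) where
  open Group G
  open import Algebra.Properties.Group G

  ⁻¹-≉ε : ∀ {x} → x ≉ ε → x ⁻¹ ≉ ε
  ⁻¹-≉ε x≉ε x⁻¹≈ε = x≉ε (⁻¹-injective (trans x⁻¹≈ε (sym ε⁻¹≈ε)))

  ≅ℤ-byEnumeration : ∀ n .{{_ : NonZero n}} (ψ : Fin n → Carrier) →
                     ψ (0 mod n) ≈ ε →
                     (∀ i j → ψ (_+ₙ_ n i j) ≈ ψ i ∙ ψ j) →
                     (∀ i → ψ (-ₙ_ n i) ≈ ψ i ⁻¹) →
                     (∀ {i j} → ψ i ≈ ψ j → i ≡ j) →
                     (∀ z → ∃ λ i → z ≈ ψ i) →
                     G ≅ℤ n
  ≅ℤ-byEnumeration n ψ ψ-ε ψ-∙ ψ-⁻¹ ψ-injective ψ-surjective = φ , record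
    { isGroupMonomorphism = record
      { isGroupHomomorphism = record
        { isMonoidHomomorphism = record
          { isMagmaHomomorphism = record
            { isRelHomomorphism = record { cong = φ-cong }
            ; homo = λ z w → φ-by (trans (∙-cong (ψφ z) (ψφ w)) (sym (ψ-∙ (φ z) (φ w))))
            }
          ; ε-homo = φ-by (sym ψ-ε)
          }
        ; ⁻¹-homo = λ z → φ-by (trans (⁻¹-cong (ψφ z)) (sym (ψ-⁻¹ (φ z))))
        }
      ; injective = λ φz≡φw → trans (ψφ _) (trans (reflexive (≡.cong ψ φz≡φw)) (sym (ψφ _)))
      }
    ; surjective = λ i → ψ i , φ-by
    }
    where
    φ : Carrier → Fin n
    φ z = proj₁ (ψ-surjective z)

    ψφ : ∀ z → z ≈ ψ (φ z)
    ψφ z = proj₂ (ψ-surjective z)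

    φ-cong : ∀ {z w} → z ≈ w → φ z ≡ φ w
    φ-cong {z} {w} z≈w = ψ-injective (trans (sym (ψφ z)) (trans z≈w (ψφ w)))

    φ-by : ∀ {z i} → z ≈ ψ i → φ z ≡ i
    φ-by {z} z≈ψi = ψ-injective (trans (sym (ψφ z)) z≈ψi)

  ≅ℤ2-byElements : ∀ {a} → a ≉ ε → a ∙ a ≈ ε → (∀ z → z ≈ ε ⊎ z ≈ a) → G ≅ℤ 2
  ≅ℤ2-byElements {a} a≉ε aa≈ε classify =
    ≅ℤ-byEnumeration 2 ψ refl ψ-∙ ψ-⁻¹ ψ-injective ψ-surjective
    where
    ψ : Fin 2 → Carrier
    ψ zero       = ε
    ψ (suc zero) = a

    ψ-∙ : ∀ i j → ψ (_+ₙ_ 2 i j) ≈ ψ i ∙ ψ j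
    ψ-∙ zero       zero       = sym (identityˡ ε)
    ψ-∙ zero       (suc zero) = sym (identityˡ a)
    ψ-∙ (suc zero) zero       = sym (identityʳ a)
    ψ-∙ (suc zero) (suc zero) = sym aa≈ε

    ψ-⁻¹ : ∀ i → ψ (-ₙ_ 2 i) ≈ ψ i ⁻¹
    ψ-⁻¹ zero       = sym ε⁻¹≈ε
    ψ-⁻¹ (suc zero) = inverseˡ-unique a a aa≈ε

    ψ-injective : ∀ {i j} → ψ i ≈ ψ j → i ≡ j
    ψ-injective {zero}     {zero}     _   = ≡.refl
    ψ-injective {zero}     {suc zero} ε≈a = contradiction (sym ε≈a) a≉ε
    ψ-injective {suc zero} {zero}     a≈ε = contradiction a≈ε a≉ε
    ψ-injective {suc zero} {suc zero} _   = ≡.refl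

    ψ-surjective : ∀ z → ∃ λ i → z ≈ ψ i
    ψ-surjective z = [ (λ z≈ε → zero , z≈ε) , (λ z≈a → suc zero , z≈a) ]′ (classify z)

  ≅ℤ3-byElements : ∀ {a} → a ≉ ε → a ≉ a ⁻¹ → (∀ z → z ≈ ε ⊎ z ≈ a ⊎ z ≈ a ⁻¹) → G ≅ℤ 3
  ≅ℤ3-byElements {a} a≉ε a≉a⁻¹ classify =
    ≅ℤ-byEnumeration 3 ψ refl ψ-∙ ψ-⁻¹ ψ-injective ψ-surjective
    where
    aa≈a⁻¹ : a ∙ a ≈ a ⁻¹
    aa≈a⁻¹ with classify (a ∙ a)
    ... | inj₁ aa≈ε        = contradiction (inverseˡ-unique a a aa≈ε) a≉a⁻¹
    ... | inj₂ (inj₁ aa≈a) = contradiction (identityʳ-unique a a aa≈a) a≉ε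
    ... | inj₂ (inj₂ aa≈a⁻¹) = aa≈a⁻¹

    a⁻¹a⁻¹≈a : a ⁻¹ ∙ a ⁻¹ ≈ a
    a⁻¹a⁻¹≈a = trans (sym (⁻¹-anti-homo-∙ a a)) (trans (⁻¹-cong aa≈a⁻¹) (⁻¹-involutive a))

    ψ : Fin 3 → Carrier
    ψ zero             = ε
    ψ (suc zero)       = a
    ψ (suc (suc zero)) = a ⁻¹

    ψ-∙ : ∀ i j → ψ (_+ₙ_ 3 i j) ≈ ψ i ∙ ψ j
    ψ-∙ zero             zero             = sym (identityˡ ε)
    ψ-∙ zero             (suc zero)       = sym (identityˡ a)
    ψ-∙ zero             (suc (suc zero)) = sym (identityˡ (a ⁻¹))
    ψ-∙ (suc zero)       zero             = sym (identityʳ a)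
    ψ-∙ (suc zero)       (suc zero)       = sym aa≈a⁻¹
    ψ-∙ (suc zero)       (suc (suc zero)) = sym (inverseʳ a)
    ψ-∙ (suc (suc zero)) zero             = sym (identityʳ (a ⁻¹))
    ψ-∙ (suc (suc zero)) (suc zero)       = sym (inverseˡ a)
    ψ-∙ (suc (suc zero)) (suc (suc zero)) = sym a⁻¹a⁻¹≈a

    ψ-⁻¹ : ∀ i → ψ (-ₙ_ 3 i) ≈ ψ i ⁻¹
    ψ-⁻¹ zero             = sym ε⁻¹≈ε
    ψ-⁻¹ (suc zero)       = refl
    ψ-⁻¹ (suc (suc zero)) = sym (⁻¹-involutive a)

    ψ-injective : ∀ {i j} → ψ i ≈ ψ j → i ≡ j
    ψ-injective {zero}             {zero}             _ = ≡.refl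
    ψ-injective {suc zero}         {suc zero}         _ = ≡.refl
    ψ-injective {suc (suc zero)}   {suc (suc zero)}   _ = ≡.refl
    ψ-injective {zero}             {suc zero}         ε≈a = contradiction (sym ε≈a) a≉ε
    ψ-injective {zero}             {suc (suc zero)}   ε≈a⁻¹ = contradiction (sym ε≈a⁻¹) (⁻¹-≉ε a≉ε)
    ψ-injective {suc zero}         {zero}             a≈ε = contradiction a≈ε a≉ε
    ψ-injective {suc zero}         {suc (suc zero)}   a≈a⁻¹ = contradiction a≈a⁻¹ a≉a⁻¹
    ψ-injective {suc (suc zero)}   {zero}             a⁻¹≈ε = contradiction a⁻¹≈ε (⁻¹-≉ε a≉ε)
    ψ-injective {suc (suc zero)}   {suc zero}         a⁻¹≈a = contradiction (sym a⁻¹≈a) a≉a⁻¹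

    ψ-surjective : ∀ z → ∃ λ i → z ≈ ψ i
    ψ-surjective z = [ (λ z≈ε → zero , z≈ε)
                     , [ (λ z≈a → suc zero , z≈a) , (λ z≈a⁻¹ → suc (suc zero) , z≈a⁻¹) ]′ ]′ (classify z)

module FiniteEndoStarTree {c ℓ} (G : Group c ℓ) (finite : IsFinite G)
                          (connected : Connected (EndoStar G)) (acyclic : Acyclic (EndoStar G)) where
  open Group G
  open import Algebra.Properties.Group G
  open Endomorphisms G
  open Finite G finite using (_≟_)
  open EndoStarTree G _≟_ connected acyclic
  open Recognition G

  ε-central : ∀ {x} y → x ≈ ε → x ∙ y ≈ y ∙ x
  ε-central y x≈ε = trans (∙-congʳ x≈ε) (trans (identityˡ y) (sym (trans (∙-congˡ x≈ε) (identityʳ y))))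

  tree⇒comm : Commutative _≈_ _∙_
  tree⇒comm a g = decidable-stable (a ∙ g ≟ g ∙ a) commute
    where
    a′ : Carrier
    a′ = conjugate g a

    a′g≈ga : a′ ∙ g ≈ g ∙ a
    a′g≈ga = //-rightDividesˡ g (g ∙ a)

    commute : ¬ a ∙ g ≉ g ∙ a
    commute ag≉ga = [ ag≉ga ∘ g≈a⇒commute , ag≉ga ∘ g≈a′⇒commute ]′
      (mutually-reachable⇒exhaustive a≉ε a′≉ε a≉a′ (↝-conjugate g a) (conjugate-↝ g a) g≉ε)
      where
      a≉ε : a ≉ ε
      a≉ε = ag≉ga ∘ ε-central g

      g≉ε : g ≉ ε
      g≉ε = ag≉ga ∘ sym ∘ ε-central a

      a≉a′ : a ≉ a′
      a≉a′ a≈a′ = ag≉ga (trans (∙-congʳ a≈a′) a′g≈ga)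

      a′≉ε : a′ ≉ ε
      a′≉ε a′≈ε = a≉ε (identityʳ-unique g a (trans (sym a′g≈ga) (trans (∙-congʳ a′≈ε) (identityˡ g))))

      g≈a⇒commute : g ≈ a → a ∙ g ≈ g ∙ a
      g≈a⇒commute g≈a = ∙-cong (sym g≈a) g≈a

      g≈a′⇒commute : g ≈ a′ → a ∙ g ≈ g ∙ a
      g≈a′⇒commute g≈a′ = g≈a⇒commute (∙-cancelˡ g g a (trans (∙-congʳ g≈a′) a′g≈ga))

  ↝-⁻¹ : ∀ z → z ↝ z ⁻¹
  ↝-⁻¹ z = _⁻¹ , ⁻¹-isEndomorphism tree⇒comm , refl

  ⁻¹-↝ : ∀ z → z ⁻¹ ↝ z
  ⁻¹-↝ z = _⁻¹ , ⁻¹-isEndomorphism tree⇒comm , ⁻¹-involutive z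

  not-self-inverse⇒≅ℤ3 : ∀ {a} → a ≉ ε → a ⁻¹ ≉ a → G ≅ℤ 3
  not-self-inverse⇒≅ℤ3 {a} a≉ε a⁻¹≉a = ≅ℤ3-byElements a≉ε (a⁻¹≉a ∘ sym) classify
    where
    classify : ∀ z → z ≈ ε ⊎ z ≈ a ⊎ z ≈ a ⁻¹
    classify z with z ≟ ε
    ... | yes z≈ε = inj₁ z≈ε
    ... | no z≉ε  = inj₂ (mutually-reachable⇒exhaustive a≉ε (⁻¹-≉ε a≉ε) (a⁻¹≉a ∘ sym)
                                                        (↝-⁻¹ a) (⁻¹-↝ a) z≉ε)

  self-inverse-resp : ∀ {x y} → x ⁻¹ ≈ x → x ≈ y → y ⁻¹ ≈ y
  self-inverse-resp x⁻¹≈x x≈y = trans (⁻¹-cong (sym x≈y)) (trans x⁻¹≈x x≈y)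

  self-inverse⇒exponent-two : ∀ {a} → a ≉ ε → a ⁻¹ ≈ a → HasExponentTwo G
  self-inverse⇒exponent-two {a} a≉ε a⁻¹≈a z =
    trans (∙-congˡ (sym (decidable-stable (z ⁻¹ ≟ z) not-self-inverse-absurd))) (inverseʳ z)
    where
    not-self-inverse-absurd : ¬ z ⁻¹ ≉ z
    not-self-inverse-absurd z⁻¹≉z =
      [ z⁻¹≉z ∘ self-inverse-resp a⁻¹≈a
      , z⁻¹≉z ∘ sym ∘ trans (sym (⁻¹-involutive z)) ∘ self-inverse-resp a⁻¹≈a ]′
      (mutually-reachable⇒exhaustive z≉ε (⁻¹-≉ε z≉ε) (z⁻¹≉z ∘ sym) (↝-⁻¹ z) (⁻¹-↝ z) a≉ε)
      where
      z≉ε : z ≉ ε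
      z≉ε = z⁻¹≉z ∘ self-inverse-resp ε⁻¹≈ε ∘ sym

  self-inverse⇒≅ℤ2 : ∀ {a} → a ≉ ε → a ⁻¹ ≈ a → G ≅ℤ 2
  self-inverse⇒≅ℤ2 {a} a≉ε a⁻¹≈a = ≅ℤ2-byElements a≉ε (square≈ε a) classify
    where
    square≈ε : HasExponentTwo G
    square≈ε = self-inverse⇒exponent-two a≉ε a⁻¹≈a

    open ExponentTwo G finite square≈ε using (nonidentity-↝)

    classify : ∀ z → z ≈ ε ⊎ z ≈ a
    classify z with z ≟ ε | z ≟ a
    ... | yes z≈ε | _       = inj₁ z≈ε
    ... | no _    | yes z≈a = inj₂ z≈a
    ... | no z≉ε  | no z≉a  = ⊥-elim ([ z≉ε ∘ identityʳ-unique a z , a≉ε ∘ identityˡ-unique a z ]′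
      (mutually-reachable⇒exhaustive a≉ε z≉ε (z≉a ∘ sym)
                                     (nonidentity-↝ a≉ε z) (nonidentity-↝ z≉ε a) az≉ε))
      where
      az≉ε : a ∙ z ≉ ε
      az≉ε az≈ε = z≉a (trans (inverseʳ-unique a z az≈ε) a⁻¹≈a)

  nonidentity⇒≅ℤ2⊎≅ℤ3 : ∀ {a} → a ≉ ε → G ≅ℤ 2 ⊎ G ≅ℤ 3
  nonidentity⇒≅ℤ2⊎≅ℤ3 {a} a≉ε with a ⁻¹ ≟ a
  ... | yes a⁻¹≈a = inj₁ (self-inverse⇒≅ℤ2 a≉ε a⁻¹≈a)
  ... | no a⁻¹≉a  = inj₂ (not-self-inverse⇒≅ℤ3 a≉ε a⁻¹≉a)

tree⇒≅ℤ2⊎≅ℤ3 : ∀ {c ℓ} (G : Group c ℓ) → IsFinite G → IsTree (EndoStar G) → G ≅ℤ 2 ⊎ G ≅ℤ 3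
tree⇒≅ℤ2⊎≅ℤ3 G finite ((_ , a≉ε) , connected , acyclic) =
  FiniteEndoStarTree.nonidentity⇒≅ℤ2⊎≅ℤ3 G finite connected acyclic a≉ε

-- With the order written as suc n, 0 mod suc n reduces to zero, so ε-homo reads φ ε ≡ zero.
module Cyclic {c ℓ} (G : Group c ℓ) {n} (iso : G ≅ℤ ℕ.suc n) where
  open Group G
  open Graph (EndoStar G) using (V)
  open GroupMorphisms.IsGroupIsomorphism (proj₂ iso) public

  φ : Carrier → Fin (ℕ.suc n)
  φ = proj₁ iso

  comm : Commutative _≈_ _∙_
  comm a b = injective (≡.trans (∙-homo a b)
    (≡.trans (≡.cong (_mod ℕ.suc n) (ℕₚ.+-comm (toℕ (φ a)) (toℕ (φ b)))) (≡.sym (∙-homo b a))))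

  φ-vertex≢0 : (p : V) → φ (proj₁ p) ≢ zero
  φ-vertex≢0 (z , z≉ε) φz≡0 = z≉ε (injective (≡.trans φz≡0 (≡.sym ε-homo)))

  vertex-over : ∀ {i} → i ≢ zero → V
  vertex-over {i} i≢0 with surjective i
  ... | z , φz≡i = z , λ z≈ε → i≢0 (≡.trans (≡.sym (φz≡i refl)) (≡.trans (⟦⟧-cong z≈ε) ε-homo))

module _ {c ℓ} (G : Group c ℓ) where
  open Group G
  open Graph (EndoStar G) using (_≃_; Adj)

  ≅ℤ2⇒tree : G ≅ℤ 2 → IsTree (EndoStar G)
  ≅ℤ2⇒tree iso = vertex-over {suc zero} (λ ()) , (λ p q → inj₁ (all-equal p q)) ,
                 at-most-two-vertices⇒acyclic (EndoStar G) (λ p q _ → inj₁ (all-equal p q))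
    where
    open Cyclic G iso

    nonzero-unique : ∀ {i j : Fin 2} → i ≢ zero → j ≢ zero → i ≡ j
    nonzero-unique {zero}                i≢0 _   = contradiction ≡.refl i≢0
    nonzero-unique {suc zero} {zero}     _   j≢0 = contradiction ≡.refl j≢0
    nonzero-unique {suc zero} {suc zero} _   _   = ≡.refl

    all-equal : ∀ p q → p ≃ q
    all-equal p q = injective (nonzero-unique (φ-vertex≢0 p) (φ-vertex≢0 q))

  ≅ℤ3⇒tree : G ≅ℤ 3 → IsTree (EndoStar G)
  ≅ℤ3⇒tree iso = vertex-over {suc zero} (λ ()) , connected ,
                 at-most-two-vertices⇒acyclic (EndoStar G) at-most-two
    where
    open Cyclic G iso

    pigeonhole : ∀ {i j k : Fin 3} → i ≢ zero → j ≢ zero → k ≢ zero → i ≡ j ⊎ j ≡ k ⊎ i ≡ k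
    pigeonhole {zero}                                      i≢0 _   _   = contradiction ≡.refl i≢0
    pigeonhole {_}              {zero}                     _   j≢0 _   = contradiction ≡.refl j≢0
    pigeonhole {_}              {_}              {zero}    _   _   k≢0 = contradiction ≡.refl k≢0
    pigeonhole {suc zero}       {suc zero}       {suc _}   _   _   _   = inj₁ ≡.refl
    pigeonhole {suc (suc zero)} {suc (suc zero)} {suc _}   _   _   _   = inj₁ ≡.refl
    pigeonhole {suc zero}       {suc (suc zero)} {suc zero}       _ _ _ = inj₂ (inj₂ ≡.refl)
    pigeonhole {suc zero}       {suc (suc zero)} {suc (suc zero)} _ _ _ = inj₂ (inj₁ ≡.refl)
    pigeonhole {suc (suc zero)} {suc zero}       {suc zero}       _ _ _ = inj₂ (inj₁ ≡.refl)
    pigeonhole {suc (suc zero)} {suc zero}       {suc (suc zero)} _ _ _ = inj₂ (inj₂ ≡.refl)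

    distinct-nonzero⇒negation : ∀ {i j : Fin 3} → i ≢ zero → j ≢ zero → i ≢ j → j ≡ -ₙ_ 3 i
    distinct-nonzero⇒negation {zero}                                i≢0 _   _   = contradiction ≡.refl i≢0
    distinct-nonzero⇒negation {_}              {zero}               _   j≢0 _   = contradiction ≡.refl j≢0
    distinct-nonzero⇒negation {suc zero}       {suc zero}           _   _   i≢j = contradiction ≡.refl i≢j
    distinct-nonzero⇒negation {suc zero}       {suc (suc zero)}     _   _   _   = ≡.refl
    distinct-nonzero⇒negation {suc (suc zero)} {suc zero}           _   _   _   = ≡.refl
    distinct-nonzero⇒negation {suc (suc zero)} {suc (suc zero)}     _   _   i≢j = contradiction ≡.refl i≢j

    at-most-two : ∀ p q r → p ≃ q ⊎ q ≃ r ⊎ p ≃ r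
    at-most-two p q r = Sum.map injective (Sum.map injective injective)
      (pigeonhole (φ-vertex≢0 p) (φ-vertex≢0 q) (φ-vertex≢0 r))

    connected : Connected (EndoStar G)
    connected p q with φ (proj₁ p) Fin.≟ φ (proj₁ q)
    ... | yes φp≡φq = inj₁ (injective φp≡φq)
    ... | no φp≢φq  = inj₂ (p~q ◅ ε★)
      where
      p~q : Adj p q
      p~q = φp≢φq ∘ ⟦⟧-cong , inj₁ (_⁻¹ , Endomorphisms.⁻¹-isEndomorphism G comm ,
              injective (≡.trans (⁻¹-homo (proj₁ p))
                          (≡.sym (distinct-nonzero⇒negation (φ-vertex≢0 p) (φ-vertex≢0 q) φp≢φq))))

theorem2p17 : ∀ {c ℓ} (G : Group c ℓ) → IsFinite G →
    IsTree (EndoStar G) ⇔ (G ≅ℤ 2 ⊎ G ≅ℤ 3)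
theorem2p17 G finite = mk⇔ (tree⇒≅ℤ2⊎≅ℤ3 G finite) [ ≅ℤ2⇒tree G , ≅ℤ3⇒tree G ]′
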